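{- Let $G$ be a maximal $3$-$\gamma_{c}$-vertex critical graph of order $n$, let $I$ be a maximum independent set of $G$, and let $W$ be the vertex set of a maximum complete subgraph of $G$ chosen so that $|I \cap W|$ is minimum among all such vertex sets. If $|I| + |W| = n - 1$, then $|W \cap I| = 0$.
   Context: All graphs are finite, simple and connected. A connected dominating set of $G$ is a set $D \subseteq V(G)$ such that every vertex of $G$ is in $D$ or adjacent to a vertex of $D$, and $G[D]$ is connected; $\gamma_{c}(G)$ is the minimum size of such a set. $G$ is $k$-$\gamma_{c}$-edge critical if $\gamma_{c}(G)=k$ and $\gamma_{c}(G+uv)<k$ for every pair of non-adjacent vertices $u,v$. A $2$-connected graph $G$ is $k$-$\gamma_{c}$-vertex critical if $\gamma_{c}(G)=k$ and $\gamma_{c}(G-v)<k$ for every $v \in V(G)$. $G$ is maximal $k$-$\gamma_{c}$-vertex critical if it is both $k$-$\gamma_{c}$-edge critical and $k$-$\gamma_{c}$-vertex critical. -}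

module Defs where

open import Data.Nat using (ℕ; _<_; _≤_)
open import Data.Fin using (Fin)
open import Data.Fin.Subset using (Subset; _∈_; _∉_; _⊆_; ∣_∣; ⁅_⁆; ∁; _∩_; _─_)
open import Data.Product using (Σ; _×_; ∃; ∃-syntax)
open import Data.Sum using (_⊎_)
open import Relation.Nullary using (¬_; Dec)
open import Relation.Binary.PropositionalEquality using (_≡_)

Rel : ℕ → Set₁
Rel n = Fin n → Fin n → Set

record Graph (n : ℕ) : Set₁ where
  field
    Adj   : Rel n
    sym   : ∀ {x y} → Adj x y → Adj y x
    irr   : ∀ {x} → ¬ Adj x x
    dec   : ∀ x y → Dec (Adj x y)
open Graph public

addEdge : ∀ {n} → Rel n → Fin n → Fin n → Rel n
addEdge R u v x y = R x y ⊎ ((x ≡ u × y ≡ v) ⊎ (x ≡ v × y ≡ u))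

data Reach {n : ℕ} (R : Rel n) (S : Subset n) : Fin n → Fin n → Set where
  here : ∀ {u} → u ∈ S → Reach R S u u
  step : ∀ {u w v} → u ∈ S → R u w → Reach R S w v → Reach R S u v

Connected : ∀ {n} → Rel n → Subset n → Set
Connected R S = (∃[ x ] x ∈ S) × (∀ {u v} → u ∈ S → v ∈ S → Reach R S u v)

IsCDS : ∀ {n} → Rel n → Subset n → Subset n → Set
IsCDS R U D =
  D ⊆ U ×
  (∀ {v} → v ∈ U → v ∈ D ⊎ (∃[ u ] (u ∈ D × R u v))) ×
  Connected R D

GammaCEq : ∀ {n} → Rel n → Subset n → ℕ → Set
GammaCEq R U k = (∃[ D ] (IsCDS R U D × ∣ D ∣ ≡ k)) × (∀ D → IsCDS R U D → k ≤ ∣ D ∣)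

GammaCLt : ∀ {n} → Rel n → Subset n → ℕ → Set
GammaCLt R U k = ∃[ D ] (IsCDS R U D × ∣ D ∣ < k)

full : ∀ {n} → Subset n
full = ∁ (Data.Fin.Subset.⊥)

-- G - v as the induced subgraph on V(G) \ {v}.
minusV : ∀ {n} → Fin n → Subset n
minusV v = full ─ ⁅ v ⁆

TwoConnected : ∀ {n} → Graph n → Set
TwoConnected {n} G = (3 ≤ n) × Connected (Adj G) full × (∀ v → Connected (Adj G) (minusV v))

EdgeCritical : ∀ {n} → Graph n → ℕ → Set
EdgeCritical G k = Connected (Adj G) full × GammaCEq (Adj G) full k ×
  (∀ u v → u ≢ v → ¬ Adj G u v → GammaCLt (addEdge (Adj G) u v) full k)
  where
  open import Relation.Binary.PropositionalEquality using (_≢_)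

VertexCritical : ∀ {n} → Graph n → ℕ → Set
VertexCritical G k = TwoConnected G × GammaCEq (Adj G) full k ×
  (∀ v → GammaCLt (Adj G) (minusV v) k)

MaximalVertexCritical : ∀ {n} → Graph n → ℕ → Set
MaximalVertexCritical G k = EdgeCritical G k × VertexCritical G k

Independent : ∀ {n} → Graph n → Subset n → Set
Independent G I = ∀ {x y} → x ∈ I → y ∈ I → ¬ Adj G x y

MaxIndependent : ∀ {n} → Graph n → Subset n → Set
MaxIndependent G I = Independent G I × (∀ J → Independent G J → ∣ J ∣ ≤ ∣ I ∣)

Clique : ∀ {n} → Graph n → Subset n → Set
Clique G W = ∀ {x y} → x ∈ W → y ∈ W → x ≢ y → Adj G x y
  where
  open import Relation.Binary.PropositionalEquality using (_≢_)

MaxClique : ∀ {n} → Graph n → Subset n → Set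
MaxClique G W = Clique G W × (∀ W' → Clique G W' → ∣ W' ∣ ≤ ∣ W ∣)

-- A dominating pair is {u, w} with u = w or uw ∈ E(G) dominating G.  Since γc(G) = 3 no such
-- pair exists; each G − v has one (vertex-criticality), and its members are then distinct
-- from and nonadjacent to v (an "avoiding pair"); each G + uv has one (edge-criticality).
-- Suppose x ∈ I ∩ W.  Then I ∩ W = {x} and exactly two vertices lie outside I ∪ W.  By
-- minimality no clique of size ≥ |W| misses I, so no outside vertex is adjacent to all of
-- W − x.  The avoiding pairs of x and of the vertices of W − x single out the outside
-- vertices c, c' (c' ~ x, c ≁ x, c ≁ ws for some ws ∈ W − x); edge-criticality at c·ws gives
-- c ~ c', after which either {c', x} dominates G or {c, c'} is a clique replacing W.
module Submission where

open import Defs hiding (sym; irr; dec)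
open import Data.Nat using (ℕ; zero; suc; _+_; _∸_; _≤_; _<_; z≤n; s≤s)
open import Data.Nat.Properties
  using (module ≤-Reasoning; +-suc; +-comm; ≤-trans; ≤-reflexive; m≤m+n; m+n∸n≡m; n≮0;
         suc-injective; +-cancelˡ-≡)
open import Data.Fin using (Fin; _≟_)
open import Data.Fin.Properties using (any?)
open import Data.Fin.Subset
  using (Subset; _∈_; _∉_; _⊆_; ∣_∣; ⁅_⁆; ∁; _∪_; _∩_; _─_; _-_; inside; outside; Nonempty; Empty)
open import Data.Fin.Subset.Properties
  using (_∈?_; p─⊥≡p; Empty-unique; ∣⊥∣≡0; nonempty?; x∈p∧x≢y⇒x∈p-y; x∈p∪q⁺; x∈p∪q⁻;
         x∈p∩q⁺; x∈p∩q⁻; x∈⁅x⁆; x∈⁅y⁆⇒x≡y; ∣⁅x⁆∣≡1; p─q⊆p; p⊆q⇒∣p∣≤∣q∣; ∣∁p∣≡n∸∣p∣;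
         x∈∁p⇒x∉p; x∉p⇒x∈∁p; ∉⊥)
open import Data.Vec using ([]; _∷_; here; there)
open import Data.Product using (Σ; _×_; _,_; ∃; proj₁; proj₂)
open import Data.Sum using (_⊎_; inj₁; inj₂; [_,_]′) renaming (swap to ⊎-swap)
open import Data.Empty using (⊥; ⊥-elim)
open import Relation.Nullary using (¬_; yes; no)
open import Relation.Nullary.Decidable using (_×-dec_; ¬?)
open import Relation.Unary using (Decidable)
open import Relation.Binary.Definitions using (Symmetric)
open import Relation.Binary.PropositionalEquality
  using (_≡_; _≢_; refl; sym; trans; cong; cong₂; subst; module ≡-Reasoning)

private variable
  n : ℕ
  R : Rel n
  G : Graph n
  p q D S U W : Subset n
  s t u v w x y z : Fin n

∣p∣≡1+∣p-x∣ : x ∈ p → ∣ p ∣ ≡ suc ∣ p - x ∣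
∣p∣≡1+∣p-x∣ {p = inside ∷ p} here = cong (λ r → suc ∣ r ∣) (sym (p─⊥≡p p))
∣p∣≡1+∣p-x∣ {p = outside ∷ p} (there x∈p) = ∣p∣≡1+∣p-x∣ x∈p
∣p∣≡1+∣p-x∣ {p = inside ∷ p} (there x∈p) = cong suc (∣p∣≡1+∣p-x∣ x∈p)

x∈p─q⇒x∉q : x ∈ p ─ q → x ∉ q
x∈p─q⇒x∉q {p = _ ∷ _} {q = inside ∷ _} () here
x∈p─q⇒x∉q {p = _ ∷ _} {q = _ ∷ _} (there x∈p─q) (there x∈q) = x∈p─q⇒x∉q x∈p─q x∈q

x∈p-y⁻ : x ∈ p - y → x ∈ p × x ≢ y
x∈p-y⁻ {p = p} {y = y} x∈p-y =
  p─q⊆p p ⁅ y ⁆ x∈p-y , λ { refl → x∈p─q⇒x∉q x∈p-y (x∈⁅x⁆ y) }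

peel : ∀ x → z ∈ p → z ≡ x ⊎ z ∈ p - x
peel {z = z} x z∈p with z ≟ x
... | yes z≡x = inj₁ z≡x
... | no z≢x = inj₂ (x∈p∧x≢y⇒x∈p-y z∈p z≢x)

Empty⇒∣p∣≡0 : ∀ {n} {p : Subset n} → Empty p → ∣ p ∣ ≡ 0
Empty⇒∣p∣≡0 {n = n} empty = trans (cong ∣_∣ (Empty-unique empty)) (∣⊥∣≡0 n)

∣p∣≤0⇒x∉p : ∣ p ∣ ≤ 0 → x ∉ p
∣p∣≤0⇒x∉p ∣p∣≤0 x∈p with ≤-trans (≤-reflexive (sym (∣p∣≡1+∣p-x∣ x∈p))) ∣p∣≤0
... | ()

nonempty-of-size : ∀ {k} → ∣ p ∣ ≡ suc k → Nonempty p
nonempty-of-size {p = p} size with nonempty? p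
... | yes ne = ne
... | no empty with trans (sym size) (Empty⇒∣p∣≡0 empty)
...   | ()

covered-by-two : ∀ x y → ∣ p - x - y ∣ ≤ 0 → z ∈ p → z ≡ x ⊎ z ≡ y
covered-by-two x y rest≤0 z∈p with peel x z∈p
... | inj₁ z≡x = inj₁ z≡x
... | inj₂ z∈p-x with peel y z∈p-x
...   | inj₁ z≡y = inj₂ z≡y
...   | inj₂ z∈p-x-y = ⊥-elim (∣p∣≤0⇒x∉p rest≤0 z∈p-x-y)

∣p∣≡2+∣p-x-y∣ : x ∈ p → y ∈ p - x → ∣ p ∣ ≡ 2 + ∣ p - x - y ∣
∣p∣≡2+∣p-x-y∣ x∈p y∈p-x = trans (∣p∣≡1+∣p-x∣ x∈p) (cong suc (∣p∣≡1+∣p-x∣ y∈p-x))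

at-most-two : x ∈ p → ∣ p ∣ ≤ 2 → ∃ λ y → y ∈ p × (∀ {z} → z ∈ p → z ≡ x ⊎ z ≡ y)
at-most-two {x = x} {p = p} x∈p size≤2 with nonempty? (p - x)
... | no empty = x , x∈p , λ z∈p → inj₁ (only-x z∈p)
  where
  only-x : z ∈ p → z ≡ x
  only-x z∈p with peel x z∈p
  ... | inj₁ z≡x = z≡x
  ... | inj₂ z∈p-x = ⊥-elim (empty (_ , z∈p-x))
... | yes (y , y∈p-x) = y , proj₁ (x∈p-y⁻ y∈p-x) , covered-by-two x y rest≤0
  where
  rest≤0 : ∣ p - x - y ∣ ≤ 0
  rest≤0 with ≤-trans (≤-reflexive (sym (∣p∣≡2+∣p-x-y∣ x∈p y∈p-x))) size≤2
  ... | s≤s (s≤s le) = le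

two-elements : ∣ p ∣ ≡ 2 → ∃ λ a → ∃ λ b →
  a ≢ b × a ∈ p × b ∈ p × (∀ {z} → z ∈ p → z ≡ a ⊎ z ≡ b)
two-elements {p = p} size with nonempty-of-size size
... | a , a∈p with nonempty-of-size (suc-injective (trans (sym (∣p∣≡1+∣p-x∣ a∈p)) size))
...   | b , b∈p-a with x∈p-y⁻ b∈p-a
...     | b∈p , b≢a = a , b , (λ a≡b → b≢a (sym a≡b)) , a∈p , b∈p , covered-by-two a b rest≤0
  where
  rest≤0 : ∣ p - a - b ∣ ≤ 0
  rest≤0 = ≤-reflexive (+-cancelˡ-≡ 2 _ _ (trans (sym (∣p∣≡2+∣p-x-y∣ a∈p b∈p-a)) size))

∣p∪q∣+∣p∩q∣≡∣p∣+∣q∣ : ∀ (p q : Subset n) → ∣ p ∪ q ∣ + ∣ p ∩ q ∣ ≡ ∣ p ∣ + ∣ q ∣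
∣p∪q∣+∣p∩q∣≡∣p∣+∣q∣ [] [] = refl
∣p∪q∣+∣p∩q∣≡∣p∣+∣q∣ (outside ∷ p) (outside ∷ q) = ∣p∪q∣+∣p∩q∣≡∣p∣+∣q∣ p q
∣p∪q∣+∣p∩q∣≡∣p∣+∣q∣ (inside ∷ p) (outside ∷ q) = cong suc (∣p∪q∣+∣p∩q∣≡∣p∣+∣q∣ p q)
∣p∪q∣+∣p∩q∣≡∣p∣+∣q∣ (outside ∷ p) (inside ∷ q) =
  trans (cong suc (∣p∪q∣+∣p∩q∣≡∣p∣+∣q∣ p q)) (sym (+-suc ∣ p ∣ ∣ q ∣))
∣p∪q∣+∣p∩q∣≡∣p∣+∣q∣ (inside ∷ p) (inside ∷ q) = cong suc (begin
  ∣ p ∪ q ∣ + suc ∣ p ∩ q ∣  ≡⟨ +-suc ∣ p ∪ q ∣ ∣ p ∩ q ∣ ⟩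
  suc (∣ p ∪ q ∣ + ∣ p ∩ q ∣) ≡⟨ cong suc (∣p∪q∣+∣p∩q∣≡∣p∣+∣q∣ p q) ⟩
  suc (∣ p ∣ + ∣ q ∣)         ≡⟨ +-suc ∣ p ∣ ∣ q ∣ ⟨
  ∣ p ∣ + suc ∣ q ∣           ∎)
  where open ≡-Reasoning

exchange : Subset n → Fin n → Fin n → Subset n
exchange p x y = (p - x) ∪ ⁅ y ⁆

∈-exchange⁻ : z ∈ exchange p x y → z ≡ y ⊎ (z ∈ p × z ≢ x)
∈-exchange⁻ {p = p} {x = x} {y = y} z∈ with x∈p∪q⁻ (p - x) ⁅ y ⁆ z∈
... | inj₁ z∈p-x = inj₂ (x∈p-y⁻ z∈p-x)
... | inj₂ z∈⁅y⁆ = inj₁ (x∈⁅y⁆⇒x≡y y z∈⁅y⁆)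

∈-exchange⁺ : z ∈ p → z ≢ x → z ∈ exchange p x y
∈-exchange⁺ z∈p z≢x = x∈p∪q⁺ (inj₁ (x∈p∧x≢y⇒x∈p-y z∈p z≢x))

new∈exchange : y ∈ exchange p x y
new∈exchange {y = y} = x∈p∪q⁺ (inj₂ (x∈⁅x⁆ y))

∣p∣≤∣exchange∣ : x ∈ p → y ∉ p → ∣ p ∣ ≤ ∣ exchange p x y ∣
∣p∣≤∣exchange∣ {x = x} {p = p} {y = y} x∈p y∉p = begin
  ∣ p ∣                        ≡⟨ ∣p∣≡1+∣p-x∣ x∈p ⟩
  suc ∣ p - x ∣                ≤⟨ s≤s (p⊆q⇒∣p∣≤∣q∣ p-x⊆ex-y) ⟩
  suc ∣ exchange p x y - y ∣   ≡⟨ ∣p∣≡1+∣p-x∣ (new∈exchange {p = p} {x = x}) ⟨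
  ∣ exchange p x y ∣           ∎
  where
  open ≤-Reasoning
  p-x⊆ex-y : p - x ⊆ exchange p x y - y
  p-x⊆ex-y z∈p-x with x∈p-y⁻ z∈p-x
  ... | z∈p , z≢x = x∈p∧x≢y⇒x∈p-y (∈-exchange⁺ z∈p z≢x) λ { refl → y∉p z∈p }

∣p∣≡1 : x ∈ p → (∀ {z} → z ∈ p → z ≡ x) → ∣ p ∣ ≡ 1
∣p∣≡1 {x = x} {p = p} x∈p only-x = trans (∣p∣≡1+∣p-x∣ x∈p) (cong suc (Empty⇒∣p∣≡0 nothing-else))
  where
  nothing-else : Empty (p - x)
  nothing-else (z , z∈p-x) with x∈p-y⁻ z∈p-x
  ... | z∈p , z≢x = z≢x (only-x z∈p)

∣∁[p∪q]∣≡2 : ∀ (p q : Subset n) → ∣ p ∩ q ∣ ≡ 1 → ∣ p ∣ + ∣ q ∣ ≡ n ∸ 1 → ∣ ∁ (p ∪ q) ∣ ≡ 2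
∣∁[p∪q]∣≡2 {n} p q ∣p∩q∣≡1 sum = trans (∣∁p∣≡n∸∣p∣ (p ∪ q)) (n∸k≡2 n ∣ p ∪ q ∣ (begin
  suc ∣ p ∪ q ∣             ≡⟨ +-comm 1 ∣ p ∪ q ∣ ⟩
  ∣ p ∪ q ∣ + 1             ≡⟨ cong (∣ p ∪ q ∣ +_) (sym ∣p∩q∣≡1) ⟩
  ∣ p ∪ q ∣ + ∣ p ∩ q ∣     ≡⟨ ∣p∪q∣+∣p∩q∣≡∣p∣+∣q∣ p q ⟩
  ∣ p ∣ + ∣ q ∣             ≡⟨ sum ⟩
  n ∸ 1                     ∎))
  where
  open ≡-Reasoning
  n∸k≡2 : ∀ n k → suc k ≡ n ∸ 1 → n ∸ k ≡ 2
  n∸k≡2 zero k ()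
  n∸k≡2 (suc m) k refl = m+n∸n≡m 2 k

data Linked (R : Rel n) : Fin n → Fin n → Set where
  same : Linked R u u
  edge : R u w → Linked R u w

Dominated : Rel n → Fin n → Fin n → Fin n → Set
Dominated R u w z = Linked R u z ⊎ Linked R w z

linked-edge : Linked R u w → u ≢ w → R u w
linked-edge same u≢u = ⊥-elim (u≢u refl)
linked-edge (edge r) _ = r

dominated-edge : Dominated R u w z → u ≢ z → w ≢ z → R u z ⊎ R w z
dominated-edge (inj₁ near) u≢z _ = inj₁ (linked-edge near u≢z)
dominated-edge (inj₂ near) _ w≢z = inj₂ (linked-edge near w≢z)

-- A connected dominating set of size at most two of the graph R on U,
-- presented by its (possibly equal) two members.
record DominatingPair (R : Rel n) (U : Subset n) : Set where
  field
    first second : Fin n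
    first∈U      : first ∈ U
    second∈U     : second ∈ U
    linked       : Linked R first second
    dominates    : ∀ {z} → z ∈ U → Dominated R first second z

linked-sym : Symmetric R → Linked R u w → Linked R w u
linked-sym R-sym same = same
linked-sym R-sym (edge r) = edge (R-sym r)

walk-in-pair : (∀ {z} → z ∈ S → z ≡ u ⊎ z ≡ w) → Reach R S s w → s ≡ u → Linked R u w
walk-in-pair cover (here _) refl = same
walk-in-pair cover (step _ r rest) refl with cover (start∈ rest)
  where
  start∈ : ∀ {R : Rel n} {S a b} → Reach R S a b → a ∈ S
  start∈ (here a∈S) = a∈S
  start∈ (step a∈S _ _) = a∈S
... | inj₁ refl = walk-in-pair cover rest refl
... | inj₂ refl = edge r

pair-of-small-cds : IsCDS R U D → ∣ D ∣ < 3 → DominatingPair R U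
pair-of-small-cds {R = R} {U = U} {D = D} (D⊆U , dom , (d , d∈D) , reach) (s≤s ∣D∣≤2)
  with at-most-two d∈D ∣D∣≤2
... | y , y∈D , cover = record
  { first = d ; second = y ; first∈U = D⊆U d∈D ; second∈U = D⊆U y∈D
  ; linked = walk-in-pair cover (reach d∈D y∈D) refl ; dominates = dominated }
  where
  dominated : z ∈ U → Dominated R d y z
  dominated z∈U with dom z∈U
  ... | inj₁ z∈D with cover z∈D
  ...   | inj₁ refl = inj₁ same
  ...   | inj₂ refl = inj₂ same
  dominated z∈U | inj₂ (u , u∈D , Ruz) with cover u∈D
  ...   | inj₁ refl = inj₁ (edge Ruz)
  ...   | inj₂ refl = inj₂ (edge Ruz)

cds-of-pair : Symmetric R → (P : DominatingPair R U) →
  let open DominatingPair P in IsCDS R U (⁅ first ⁆ ∪ ⁅ second ⁆) × ∣ ⁅ first ⁆ ∪ ⁅ second ⁆ ∣ ≤ 2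
cds-of-pair {R = R} {U = U} R-sym P = (M⊆U , dom , (first , first∈M) , reach) , size
  where
  open DominatingPair P
  M : Subset _
  M = ⁅ first ⁆ ∪ ⁅ second ⁆
  first∈M : first ∈ M
  first∈M = x∈p∪q⁺ (inj₁ (x∈⁅x⁆ first))
  second∈M : second ∈ M
  second∈M = x∈p∪q⁺ (inj₂ (x∈⁅x⁆ second))
  members : z ∈ M → z ≡ first ⊎ z ≡ second
  members z∈M with x∈p∪q⁻ ⁅ first ⁆ ⁅ second ⁆ z∈M
  ... | inj₁ z∈⁅first⁆ = inj₁ (x∈⁅y⁆⇒x≡y first z∈⁅first⁆)
  ... | inj₂ z∈⁅second⁆ = inj₂ (x∈⁅y⁆⇒x≡y second z∈⁅second⁆)
  M⊆U : M ⊆ U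
  M⊆U z∈M with members z∈M
  ... | inj₁ refl = first∈U
  ... | inj₂ refl = second∈U
  dom : z ∈ U → z ∈ M ⊎ ∃ λ y → y ∈ M × R y z
  dom z∈U with dominates z∈U
  ... | inj₁ same = inj₁ first∈M
  ... | inj₁ (edge r) = inj₂ (first , first∈M , r)
  ... | inj₂ same = inj₁ second∈M
  ... | inj₂ (edge r) = inj₂ (second , second∈M , r)
  walk : ∀ {a b} → Linked R a b → a ∈ M → b ∈ M → Reach R M a b
  walk same a∈M _ = here a∈M
  walk (edge r) a∈M b∈M = step a∈M r (here b∈M)
  reach : ∀ {a b} → a ∈ M → b ∈ M → Reach R M a b
  reach a∈M b∈M with members a∈M | members b∈M
  ... | inj₁ refl | inj₁ refl = here a∈M
  ... | inj₂ refl | inj₂ refl = here a∈M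
  ... | inj₁ refl | inj₂ refl = walk linked a∈M b∈M
  ... | inj₂ refl | inj₁ refl = walk (linked-sym R-sym linked) a∈M b∈M
  size : ∣ M ∣ ≤ 2
  size = begin
    ∣ M ∣                                 ≤⟨ m≤m+n ∣ M ∣ ∣ ⁅ first ⁆ ∩ ⁅ second ⁆ ∣ ⟩
    ∣ M ∣ + ∣ ⁅ first ⁆ ∩ ⁅ second ⁆ ∣     ≡⟨ ∣p∪q∣+∣p∩q∣≡∣p∣+∣q∣ ⁅ first ⁆ ⁅ second ⁆ ⟩
    ∣ ⁅ first ⁆ ∣ + ∣ ⁅ second ⁆ ∣         ≡⟨ cong₂ _+_ (∣⁅x⁆∣≡1 first) (∣⁅x⁆∣≡1 second) ⟩
    2                                     ∎
    where open ≤-Reasoning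

no-dominating-pair : Symmetric R → (∀ D → IsCDS R U D → 3 ≤ ∣ D ∣) → ¬ DominatingPair R U
no-dominating-pair R-sym γ≥3 P with cds-of-pair R-sym P
... | cds , size with ≤-trans (γ≥3 _ cds) size
...   | s≤s (s≤s ())

∈full : ∀ (z : Fin n) → z ∈ full
∈full z = x∉p⇒x∈∁p ∉⊥

addEdge-sym : Symmetric R → Symmetric (addEdge R u v)
addEdge-sym R-sym (inj₁ r) = inj₁ (R-sym r)
addEdge-sym R-sym (inj₂ (inj₁ (s≡u , t≡v))) = inj₂ (inj₂ (t≡v , s≡u))
addEdge-sym R-sym (inj₂ (inj₂ (s≡v , t≡u))) = inj₂ (inj₁ (t≡u , s≡v))

old-edgeˡ : addEdge R u v s t → s ≢ u → s ≢ v → R s t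
old-edgeˡ (inj₁ r) _ _ = r
old-edgeˡ (inj₂ (inj₁ (s≡u , _))) s≢u _ = ⊥-elim (s≢u s≡u)
old-edgeˡ (inj₂ (inj₂ (s≡v , _))) _ s≢v = ⊥-elim (s≢v s≡v)

old-edgeʳ : addEdge R u v s t → t ≢ u → t ≢ v → R s t
old-edgeʳ (inj₁ r) _ _ = r
old-edgeʳ (inj₂ (inj₁ (_ , t≡v))) _ t≢v = ⊥-elim (t≢v t≡v)
old-edgeʳ (inj₂ (inj₂ (_ , t≡u))) t≢u _ = ⊥-elim (t≢u t≡u)

old-linked : Linked (addEdge R u v) s t → s ≢ u → s ≢ v → Linked R s t
old-linked same _ _ = same
old-linked {R = R} (edge r) s≢u s≢v = edge (old-edgeˡ {R = R} r s≢u s≢v)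

old-dominated : Dominated (addEdge R u v) s t z →
  s ≢ u → s ≢ v → t ≢ u → t ≢ v → Dominated R s t z
old-dominated (inj₁ near) s≢u s≢v _ _ = inj₁ (old-linked near s≢u s≢v)
old-dominated (inj₂ near) _ _ t≢u t≢v = inj₂ (old-linked near t≢u t≢v)

record AvoidingPair (G : Graph n) (v : Fin n) : Set where
  field
    first second : Fin n
    linked    : Linked (Adj G) first second
    dominates : ∀ {z} → z ≢ v → Dominated (Adj G) first second z
    first≢v   : first ≢ v
    second≢v  : second ≢ v
    first≁v   : ¬ Adj G first v
    second≁v  : ¬ Adj G second v

swap-avoiding : AvoidingPair G v → AvoidingPair G v
swap-avoiding {G = G} P = record
  { first = second ; second = first ; linked = linked-sym (Graph.sym G) linked
  ; dominates = λ z≢v → ⊎-swap (dominates z≢v)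
  ; first≢v = second≢v ; second≢v = first≢v ; first≁v = second≁v ; second≁v = first≁v }
  where
  open AvoidingPair P

-- When G has no dominating pair, every dominating pair of G − v avoids v:
-- a member adjacent to v would dominate v too.
avoiding-pair : (G : Graph n) → ¬ DominatingPair (Adj G) full →
  DominatingPair (Adj G) (minusV v) → AvoidingPair G v
avoiding-pair {v = v} G no-pair P = record
  { first = first ; second = second ; linked = linked
  ; dominates = λ z≢v → dominates (x∈p∧x≢y⇒x∈p-y (∈full _) z≢v)
  ; first≢v = proj₂ (x∈p-y⁻ first∈U) ; second≢v = proj₂ (x∈p-y⁻ second∈U)
  ; first≁v = λ r → no-pair (extended (inj₁ (edge r)))
  ; second≁v = λ r → no-pair (extended (inj₂ (edge r))) }
  where
  open DominatingPair P
  extended : Dominated (Adj G) first second v → DominatingPair (Adj G) full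
  extended v-dominated = record
    { first = first ; second = second ; first∈U = ∈full first ; second∈U = ∈full second
    ; linked = linked ; dominates = dominated }
    where
    dominated : z ∈ full → Dominated (Adj G) first second z
    dominated {z = z} _ with z ≟ v
    ... | yes refl = v-dominated
    ... | no z≢v = dominates (x∈p∧x≢y⇒x∈p-y (∈full z) z≢v)

neighbour-first : (G : Graph n) → AvoidingPair G v → Adj G v z →
  Σ (AvoidingPair G v) λ P → Adj G (AvoidingPair.first P) z
neighbour-first {v = v} {z = z} G P v~z with AvoidingPair.dominates P z≢v
  where
  z≢v : z ≢ v
  z≢v refl = Graph.irr G v~z
... | inj₁ (edge r) = P , r
... | inj₂ (edge r) = swap-avoiding P , r
... | inj₁ same = ⊥-elim (AvoidingPair.first≁v P (Graph.sym G v~z))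
... | inj₂ same = ⊥-elim (AvoidingPair.second≁v P (Graph.sym G v~z))

exchange-clique : (G : Graph n) → Clique G W → (∀ {w} → w ∈ W → w ≢ x → Adj G y w) →
  Clique G (exchange W x y)
exchange-clique G clique y~W p∈ q∈ p≢q with ∈-exchange⁻ p∈ | ∈-exchange⁻ q∈
... | inj₁ refl | inj₁ refl = ⊥-elim (p≢q refl)
... | inj₁ refl | inj₂ (q∈W , q≢x) = y~W q∈W q≢x
... | inj₂ (p∈W , p≢x) | inj₁ refl = Graph.sym G (y~W p∈W p≢x)
... | inj₂ (p∈W , _) | inj₂ (q∈W , _) = clique p∈W q∈W p≢q

clique∩independent : ∀ {I : Subset n} {z} (G : Graph n) → Independent G I → Clique G W →
  x ∈ I → x ∈ W → z ∈ I → z ∈ W → z ≡ x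
clique∩independent {x = x} {z = z} G indep clique x∈I x∈W z∈I z∈W with z ≟ x
... | yes z≡x = z≡x
... | no z≢x = ⊥-elim (indep z∈I x∈I (clique z∈W x∈W z≢x))

record Layout (I W : Subset n) (c c' : Fin n) : Set where
  field
    c≢c'  : c ≢ c'
    c∉I   : c ∉ I
    c∉W   : c ∉ W
    c'∉I  : c' ∉ I
    c'∉W  : c' ∉ W
    cover : ∀ z → z ∈ I ⊎ z ∈ W ⊎ z ≡ c ⊎ z ≡ c'

swap-layout : ∀ {I : Subset n} {c c'} → Layout I W c c' → Layout I W c' c
swap-layout L = record
  { c≢c' = λ c'≡c → c≢c' (sym c'≡c) ; c∉I = c'∉I ; c∉W = c'∉W ; c'∉I = c∉I ; c'∉W = c∉W
  ; cover = λ z → reorder (cover z) }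
  where
  open Layout L
  reorder : ∀ {A B C D : Set} → A ⊎ B ⊎ C ⊎ D → A ⊎ B ⊎ D ⊎ C
  reorder (inj₁ a) = inj₁ a
  reorder (inj₂ (inj₁ b)) = inj₂ (inj₁ b)
  reorder (inj₂ (inj₂ cd)) = inj₂ (inj₂ (⊎-swap cd))

layout-of-complement : ∀ {I : Subset n} → ∣ ∁ (I ∪ W) ∣ ≡ 2 → ∃ λ a → ∃ λ b → Layout I W a b
layout-of-complement {W = W} {I = I} size with two-elements size
... | a , b , a≢b , a∈ , b∈ , a-or-b = a , b , record
  { c≢c' = a≢b
  ; c∉I = λ a∈I → off-I∪W a∈ (inj₁ a∈I) ; c∉W = λ a∈W → off-I∪W a∈ (inj₂ a∈W)
  ; c'∉I = λ b∈I → off-I∪W b∈ (inj₁ b∈I) ; c'∉W = λ b∈W → off-I∪W b∈ (inj₂ b∈W)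
  ; cover = cover }
  where
  off-I∪W : ∀ {z} → z ∈ ∁ (I ∪ W) → ¬ (z ∈ I ⊎ z ∈ W)
  off-I∪W z∈ z∈I∪W = x∈∁p⇒x∉p z∈ (x∈p∪q⁺ z∈I∪W)
  cover : ∀ z → z ∈ I ⊎ z ∈ W ⊎ z ≡ a ⊎ z ≡ b
  cover z with z ∈? I | z ∈? W
  ... | yes z∈I | _ = inj₁ z∈I
  ... | no _ | yes z∈W = inj₂ (inj₁ z∈W)
  ... | no z∉I | no z∉W =
    inj₂ (inj₂ (a-or-b (x∉p⇒x∈∁p λ z∈I∪W → [ z∉I , z∉W ]′ (x∈p∪q⁻ I W z∈I∪W))))

module Configuration (G : Graph n)
  (no-pair  : ¬ DominatingPair (Adj G) full)
  (avoiding : ∀ v → AvoidingPair G v)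
  (adding   : ∀ u v → u ≢ v → ¬ Adj G u v → DominatingPair (addEdge (Adj G) u v) full)
  (I W : Subset n) (indep : Independent G I) (clique : Clique G W)
  (large-cliques-meet-I : ∀ W' → Clique G W' → ∣ W ∣ ≤ ∣ W' ∣ → ¬ (∀ z → z ∈ W' → z ∉ I))
  (x : Fin n) (x∈I : x ∈ I) (x∈W : x ∈ W)
  where

  _~_ : Fin n → Fin n → Set
  _~_ = Adj G

  ~-sym : ∀ {u v} → u ~ v → v ~ u
  ~-sym = Graph.sym G

  not-dominating : ∀ {u w} → Linked _~_ u w → ¬ (∀ z → Dominated _~_ u w z)
  not-dominating {u} {w} linked dominated = no-pair record
    { first = u ; second = w ; first∈U = ∈full u ; second∈U = ∈full w
    ; linked = linked ; dominates = λ {z} _ → dominated z }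

  only-x : ∀ {z} → z ∈ I → z ∈ W → z ≡ x
  only-x = clique∩independent G indep clique x∈I x∈W

  x~W : ∀ {w} → w ∈ W → w ≢ x → x ~ w
  x~W w∈W w≢x = clique x∈W w∈W (λ x≡w → w≢x (sym x≡w))

  search-W : ∀ {P : Fin n → Set} → Decidable P →
    (∃ λ w → w ∈ W × w ≢ x × P w) ⊎ (∀ w → w ∈ W → w ≢ x → ¬ P w)
  search-W P? with any? (λ w → (w ∈? W) ×-dec ¬? (w ≟ x) ×-dec P? w)
  ... | yes found = inj₁ found
  ... | no none = inj₂ λ w w∈W w≢x Pw → none (w , w∈W , w≢x , Pw)

  -- A vertex y outside I ∪ W misses some vertex of W − x: otherwise W − x + y
  -- would be a clique of size |W| disjoint from I.
  non-neighbour-in-W : y ∉ I → y ∉ W → ∃ λ w → w ∈ W × w ≢ x × ¬ y ~ w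
  non-neighbour-in-W {y} y∉I y∉W with search-W (λ w → ¬? (Graph.dec G y w))
  ... | inj₁ found = found
  ... | inj₂ y~W = ⊥-elim (large-cliques-meet-I (exchange W x y)
          (exchange-clique G clique adjacent) (∣p∣≤∣exchange∣ x∈W y∉W) avoids-I)
    where
    adjacent : ∀ {w} → w ∈ W → w ≢ x → y ~ w
    adjacent {w} w∈W w≢x with Graph.dec G y w
    ... | yes y~w = y~w
    ... | no y≁w = ⊥-elim (y~W w w∈W w≢x y≁w)
    avoids-I : ∀ z → z ∈ exchange W x y → z ∉ I
    avoids-I z z∈ z∈I with ∈-exchange⁻ z∈
    ... | inj₁ refl = y∉I z∈I
    ... | inj₂ (z∈W , z≢x) = z≢x (only-x z∈I z∈W)

  module Outside (c c' : Fin n) (L : Layout I W c c') (c'~x : c' ~ x) where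
    open Layout L

    x≢c : x ≢ c
    x≢c refl = c∉I x∈I

    non-neighbour-of-x : ∀ {d} → d ≢ x → ¬ d ~ x → d ∈ I ⊎ d ≡ c
    non-neighbour-of-x {d} d≢x d≁x with cover d
    ... | inj₁ d∈I = inj₁ d∈I
    ... | inj₂ (inj₁ d∈W) = ⊥-elim (d≁x (~-sym (x~W d∈W d≢x)))
    ... | inj₂ (inj₂ (inj₁ d≡c)) = inj₂ d≡c
    ... | inj₂ (inj₂ (inj₂ refl)) = ⊥-elim (d≁x c'~x)

    -- No single vertex d ≢ x, d ≁ x dominates G − x: it would have to dominate some
    -- w₀ ∈ W − x through an edge, and then {d, w₀} would dominate G.
    no-single-dominator : ∀ {d} → d ≢ x → ¬ d ~ x → ¬ (∀ {z} → z ≢ x → Dominated _~_ d d z)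
    no-single-dominator {d} d≢x d≁x dom with non-neighbour-in-W c∉I c∉W
    ... | w₀ , w₀∈W , w₀≢x , _ = not-dominating (edge d~w₀) dominated
      where
      d≢w₀ : d ≢ w₀
      d≢w₀ refl = d≁x (~-sym (x~W w₀∈W d≢x))
      d~w₀ : d ~ w₀
      d~w₀ with dominated-edge (dom w₀≢x) d≢w₀ d≢w₀
      ... | inj₁ d~w₀ = d~w₀
      ... | inj₂ d~w₀ = d~w₀
      dominated : ∀ z → Dominated _~_ d w₀ z
      dominated z with z ≟ x
      ... | yes refl = inj₂ (edge (~-sym (x~W w₀∈W w₀≢x)))
      ... | no z≢x with dom z≢x
      ...   | inj₁ near = inj₁ near
      ...   | inj₂ near = inj₁ near

    record PairOfX : Set where
      field
        i         : Fin n
        i∈I       : i ∈ I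
        i≢x       : i ≢ x
        i~c       : i ~ c
        c≁x       : ¬ c ~ x
        dominates : ∀ {z} → z ≢ x → Dominated _~_ i c z

    -- Both members of the pair avoid x, so each is in I or is c; they are adjacent.
    pair-of-x : PairOfX
    pair-of-x with avoiding x
    ... | record { first = d ; second = d ; linked = same ; dominates = dom
                 ; first≢v = d≢x ; first≁v = d≁x } = ⊥-elim (no-single-dominator d≢x d≁x dom)
    ... | record { first = d₁ ; second = d₂ ; linked = edge d₁~d₂ ; dominates = dom
                 ; first≢v = d₁≢x ; second≢v = d₂≢x ; first≁v = d₁≁x ; second≁v = d₂≁x }
      with non-neighbour-of-x d₁≢x d₁≁x | non-neighbour-of-x d₂≢x d₂≁x
    ...   | inj₁ d₁∈I | inj₁ d₂∈I = ⊥-elim (indep d₁∈I d₂∈I d₁~d₂)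
    ...   | inj₁ d₁∈I | inj₂ refl = record
            { i = d₁ ; i∈I = d₁∈I ; i≢x = d₁≢x ; i~c = d₁~d₂ ; c≁x = d₂≁x ; dominates = dom }
    ...   | inj₂ refl | inj₁ d₂∈I = record
            { i = d₂ ; i∈I = d₂∈I ; i≢x = d₂≢x ; i~c = ~-sym d₁~d₂ ; c≁x = d₁≁x
            ; dominates = λ z≢x → ⊎-swap (dom z≢x) }
    ...   | inj₂ refl | inj₂ refl = ⊥-elim (Graph.irr G d₁~d₂)

    open PairOfX pair-of-x

    c'-near-i-or-c : i ~ c' ⊎ c ~ c'
    c'-near-i-or-c = dominated-edge (dominates c'≢x) i≢c' c≢c'
      where
      i≢c' : i ≢ c'
      i≢c' i≡c' = c'∉I (subst (_∈ I) i≡c' i∈I)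
      c'≢x : c' ≢ x
      c'≢x refl = c'∉I x∈I

    only-c' : ∀ {e w} → e ~ x → w ∈ W → e ≢ w → ¬ e ~ w → e ≡ c'
    only-c' {e} e~x w∈W e≢w e≁w with cover e
    ... | inj₁ e∈I = ⊥-elim (indep e∈I x∈I e~x)
    ... | inj₂ (inj₁ e∈W) = ⊥-elim (e≁w (clique e∈W w∈W e≢w))
    ... | inj₂ (inj₂ (inj₁ refl)) = ⊥-elim (c≁x e~x)
    ... | inj₂ (inj₂ (inj₂ e≡c')) = e≡c'

    -- For w ∈ W − x, the avoiding pair of w is {c', f}: its member adjacent to x is c'.
    record PairOfW (w : Fin n) : Set where
      field
        f         : Fin n
        c'-f      : Linked _~_ c' f
        dominates : ∀ {z} → z ≢ w → Dominated _~_ c' f z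
        c'≁w      : ¬ c' ~ w
        f≁w       : ¬ f ~ w
        f≢w       : f ≢ w

    pair-of-w : ∀ {w} → w ∈ W → w ≢ x → PairOfW w
    pair-of-w w∈W w≢x with neighbour-first G (avoiding _) (~-sym (x~W w∈W w≢x))
    ... | record { first = e ; second = f ; linked = e-f ; dominates = dom
                 ; first≢v = e≢w ; second≢v = f≢w ; first≁v = e≁w ; second≁v = f≁w } , e~x
      with only-c' e~x w∈W e≢w e≁w
    ...   | refl = record
            { f = f ; c'-f = e-f ; dominates = dom ; c'≁w = e≁w ; f≁w = f≁w ; f≢w = f≢w }

    c'≁W : ∀ {w} → w ∈ W → w ≢ x → ¬ c' ~ w
    c'≁W w∈W w≢x = PairOfW.c'≁w (pair-of-w w∈W w≢x)

    neighbour-of-c' : ∀ {s} → s ~ c' → s ≢ c → s ∈ I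
    neighbour-of-c' {s} s~c' s≢c with cover s
    ... | inj₁ s∈I = s∈I
    ... | inj₂ (inj₁ s∈W) with s ≟ x
    ...   | yes refl = x∈I
    ...   | no s≢x = ⊥-elim (c'≁W s∈W s≢x (~-sym s~c'))
    neighbour-of-c' s~c' s≢c | inj₂ (inj₂ (inj₁ s≡c)) = ⊥-elim (s≢c s≡c)
    neighbour-of-c' s~c' s≢c | inj₂ (inj₂ (inj₂ refl)) = ⊥-elim (Graph.irr G s~c')

    module Missing (ws : Fin n) (ws∈W : ws ∈ W) (ws≢x : ws ≢ x) (c≁ws : ¬ c ~ ws) where

      _~⁺_ : Fin n → Fin n → Set
      _~⁺_ = addEdge _~_ c ws

      old-edgeˡ⁺ : ∀ {p q} → p ~⁺ q → p ≢ c → p ≢ ws → p ~ q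
      old-edgeˡ⁺ = old-edgeˡ {R = _~_}

      old-edgeʳ⁺ : ∀ {p q} → p ~⁺ q → q ≢ c → q ≢ ws → p ~ q
      old-edgeʳ⁺ = old-edgeʳ {R = _~_}

      ~⁺-sym : ∀ {p q} → p ~⁺ q → q ~⁺ p
      ~⁺-sym = addEdge-sym {R = _~_} ~-sym

      c≢ws : c ≢ ws
      c≢ws refl = c∉W ws∈W

      c'≢c : c' ≢ c
      c'≢c c'≡c = c≢c' (sym c'≡c)

      c'≢ws : c' ≢ ws
      c'≢ws refl = c'∉W ws∈W

      c'≁ws : ¬ c' ~ ws
      c'≁ws = c'≁W ws∈W ws≢x

      x≢ws : x ≢ ws
      x≢ws x≡ws = ws≢x (sym x≡ws)

      -- If ws were adjacent to all of I − x and i ~ c', then {ws, i} would dominate G.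
      ws-and-i : (∀ {j} → j ∈ I → j ≢ x → ws ~ j) → i ~ c' → ⊥
      ws-and-i ws~I i~c' = not-dominating (edge (ws~I i∈I i≢x)) dominated
        where
        dominated : ∀ z → Dominated _~_ ws i z
        dominated z with cover z
        ... | inj₁ z∈I with z ≟ x
        ...   | yes refl = inj₁ (edge (~-sym (x~W ws∈W ws≢x)))
        ...   | no z≢x = inj₁ (edge (ws~I z∈I z≢x))
        dominated z | inj₂ (inj₁ z∈W) with ws ≟ z
        ...   | yes refl = inj₁ same
        ...   | no ws≢z = inj₁ (edge (clique ws∈W z∈W ws≢z))
        dominated z | inj₂ (inj₂ (inj₁ refl)) = inj₂ (edge i~c)
        dominated z | inj₂ (inj₂ (inj₂ refl)) = inj₂ (edge i~c')

      module NoEdge (c≁c' : ¬ c ~ c') where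

        i~c' : i ~ c'
        i~c' with c'-near-i-or-c
        ... | inj₁ i~c' = i~c'
        ... | inj₂ c~c' = ⊥-elim (c≁c' c~c')

        off-edge : ∀ {s} → Linked _~⁺_ s c' → s ≢ c × s ≢ ws
        off-edge same = c'≢c , c'≢ws
        off-edge {s} (edge s~⁺c') = s≢c , s≢ws
          where
          s~c' : s ~ c'
          s~c' = old-edgeʳ⁺ s~⁺c' c'≢c c'≢ws
          s≢c : s ≢ c
          s≢c refl = c≁c' s~c'
          s≢ws : s ≢ ws
          s≢ws refl = c'≁ws (~-sym s~c')

        -- A dominating pair {s, c} of G + c·ws with s linked to c' fails to dominate x.
        partner-c : ∀ {s} → Linked _~⁺_ s c → (∀ z → Dominated _~⁺_ s c z) → Linked _~⁺_ s c' → ⊥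
        partner-c s-c dom same = c≁c' (~-sym (old-edgeˡ⁺ (linked-edge s-c c'≢c) c'≢c c'≢ws))
        partner-c {s} s-c dom s-c'@(edge s~⁺c') with off-edge s-c'
        ... | s≢c , s≢ws with dom x
        ...   | inj₁ same = c≁x (~-sym (old-edgeˡ⁺ (linked-edge s-c x≢c) x≢c x≢ws))
        ...   | inj₁ (edge s~⁺x) = indep s∈I x∈I (old-edgeˡ⁺ s~⁺x s≢c s≢ws)
          where
          s∈I : s ∈ I
          s∈I = neighbour-of-c' (old-edgeʳ⁺ s~⁺c' c'≢c c'≢ws) s≢c
        ...   | inj₂ c-x = c≁x (old-edgeʳ⁺ (linked-edge c-x (λ c≡x → x≢c (sym c≡x))) x≢c x≢ws)

        -- A dominating pair {s, ws} of G + c·ws with s linked to c' makes ws adjacent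
        -- to all of I − x, so {ws, i} dominates G.
        partner-ws : ∀ {s} → Linked _~⁺_ s ws → (∀ z → Dominated _~⁺_ s ws z) → Linked _~⁺_ s c' → ⊥
        partner-ws s-ws dom same = c'≁ws (old-edgeˡ⁺ (linked-edge s-ws c'≢ws) c'≢c c'≢ws)
        partner-ws {s} s-ws dom s-c'@(edge s~⁺c') with off-edge s-c'
        ... | s≢c , s≢ws = ws-and-i ws~I i~c'
          where
          s∈I : s ∈ I
          s∈I = neighbour-of-c' (old-edgeʳ⁺ s~⁺c' c'≢c c'≢ws) s≢c
          ws~I : ∀ {j} → j ∈ I → j ≢ x → ws ~ j
          ws~I {j} j∈I j≢x with dom j
          ... | inj₁ same = ~-sym (old-edgeˡ⁺ (linked-edge s-ws s≢ws) s≢c s≢ws)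
          ... | inj₁ (edge s~⁺j) = ⊥-elim (indep s∈I j∈I (old-edgeˡ⁺ s~⁺j s≢c s≢ws))
          ... | inj₂ ws-j = old-edgeʳ⁺ (linked-edge ws-j ws≢j) j≢c j≢ws
            where
            j≢c : j ≢ c
            j≢c refl = c∉I j∈I
            j≢ws : j ≢ ws
            j≢ws refl = j≢x (only-x j∈I ws∈W)
            ws≢j : ws ≢ j
            ws≢j ws≡j = j≢ws (sym ws≡j)

        no-pair⁺ : ∀ {s t} → Linked _~⁺_ s t → (∀ z → Dominated _~⁺_ s t z) → Linked _~⁺_ s c' → ⊥
        no-pair⁺ {s} {t} s-t dom s-c' with t ≟ c | t ≟ ws
        ... | yes refl | _ = partner-c s-t dom s-c'
        ... | no _ | yes refl = partner-ws s-t dom s-c'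
        ... | no t≢c | no t≢ws with off-edge s-c'
        ...   | s≢c , s≢ws = not-dominating (old-linked s-t s≢c s≢ws)
                  (λ z → old-dominated (dom z) s≢c s≢ws t≢c t≢ws)

        -- c' is dominated by some member of a dominating pair of G + c·ws.
        contradiction : ⊥
        contradiction with adding c ws c≢ws c≁ws
        ... | record { first = s ; second = t ; linked = s-t ; dominates = dom } with dom (∈full c')
        ...   | inj₁ s-c' = no-pair⁺ s-t (λ z → dom (∈full z)) s-c'
        ...   | inj₂ t-c' = no-pair⁺ (linked-sym ~⁺-sym s-t)
                                     (λ z → ⊎-swap (dom (∈full z))) t-c'

      -- Edge-criticality at the non-edge c·ws forces c ~ c'.
      c~c' : c ~ c'
      c~c' with Graph.dec G c c'
      ... | yes c~c' = c~c'
      ... | no c≁c' = ⊥-elim (NoEdge.contradiction c≁c')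

      -- If W has a third vertex w₂, the avoiding pair {c', f} of w₂ shows that c' is
      -- adjacent to all of I − x, so {c', x} dominates G.
      third-vertex : ∀ {w₂} → w₂ ∈ W → w₂ ≢ x → w₂ ≢ ws → ⊥
      third-vertex {w₂} w₂∈W w₂≢x w₂≢ws = not-dominating (edge c'~x) dominated
        where
        open PairOfW (pair-of-w w₂∈W w₂≢x) renaming (dominates to c'f-dominates)
        ws~w₂ : ws ~ w₂
        ws~w₂ = clique ws∈W w₂∈W (λ ws≡w₂ → w₂≢ws (sym ws≡w₂))
        f∈I : f ∈ I
        f∈I with dominated-edge (c'f-dominates (λ ws≡w₂ → w₂≢ws (sym ws≡w₂))) c'≢ws f≢ws
          where
          f≢ws : f ≢ ws
          f≢ws f≡ws = f≁w (subst (_~ w₂) (sym f≡ws) ws~w₂)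
        ... | inj₁ c'~ws = ⊥-elim (c'≁ws c'~ws)
        ... | inj₂ f~ws with cover f
        ...   | inj₁ f∈I = f∈I
        ...   | inj₂ (inj₁ f∈W) = ⊥-elim (f≁w (clique f∈W w₂∈W f≢w))
        ...   | inj₂ (inj₂ (inj₁ f≡c)) = ⊥-elim (c≁ws (subst (_~ ws) f≡c f~ws))
        ...   | inj₂ (inj₂ (inj₂ f≡c')) = ⊥-elim (c'≁ws (subst (_~ ws) f≡c' f~ws))
        c'~f : c' ~ f
        c'~f = linked-edge c'-f (λ c'≡f → c'∉I (subst (_∈ I) (sym c'≡f) f∈I))
        c'~I : ∀ {j} → j ∈ I → j ≢ x → c' ~ j
        c'~I {j} j∈I j≢x with j ≟ f
        ... | yes refl = c'~f
        ... | no j≢f with dominated-edge (c'f-dominates j≢w₂) c'≢j (λ f≡j → j≢f (sym f≡j))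
          where
          j≢w₂ : j ≢ w₂
          j≢w₂ refl = j≢x (only-x j∈I w₂∈W)
          c'≢j : c' ≢ j
          c'≢j refl = c'∉I j∈I
        ...   | inj₁ c'~j = c'~j
        ...   | inj₂ f~j = ⊥-elim (indep f∈I j∈I f~j)
        dominated : ∀ z → Dominated _~_ c' x z
        dominated z with z ≟ x | cover z
        ... | yes refl | _ = inj₂ same
        ... | no z≢x | inj₁ z∈I = inj₁ (edge (c'~I z∈I z≢x))
        ... | no z≢x | inj₂ (inj₁ z∈W) = inj₂ (edge (x~W z∈W z≢x))
        ... | no _ | inj₂ (inj₂ (inj₁ refl)) = inj₁ (edge (~-sym c~c'))
        ... | no _ | inj₂ (inj₂ (inj₂ refl)) = inj₁ same

      -- If W = {x, ws}, exchanging x for c and ws for c' gives the clique {c, c'},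
      -- of size |W| and disjoint from I.
      two-vertices : (∀ w → w ∈ W → w ≢ x → ¬ w ≢ ws) → ⊥
      two-vertices W⊆x,ws = large-cliques-meet-I W'' W''-clique size avoids-I
        where
        W' W'' : Subset n
        W' = exchange W x c
        W'' = exchange W' ws c'
        members : ∀ {z} → z ∈ W'' → z ≡ c' ⊎ z ≡ c
        members z∈W'' with ∈-exchange⁻ z∈W''
        ... | inj₁ z≡c' = inj₁ z≡c'
        ... | inj₂ (z∈W' , z≢ws) with ∈-exchange⁻ z∈W'
        ...   | inj₁ z≡c = inj₂ z≡c
        ...   | inj₂ (z∈W , z≢x) = ⊥-elim (W⊆x,ws _ z∈W z≢x z≢ws)
        W''-clique : Clique G W''
        W''-clique p∈ q∈ p≢q with members p∈ | members q∈
        ... | inj₁ refl | inj₁ refl = ⊥-elim (p≢q refl)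
        ... | inj₁ refl | inj₂ refl = ~-sym c~c'
        ... | inj₂ refl | inj₁ refl = c~c'
        ... | inj₂ refl | inj₂ refl = ⊥-elim (p≢q refl)
        c'∉W' : c' ∉ W'
        c'∉W' c'∈W' with ∈-exchange⁻ c'∈W'
        ... | inj₁ c'≡c = c'≢c c'≡c
        ... | inj₂ (c'∈W , _) = c'∉W c'∈W
        size : ∣ W ∣ ≤ ∣ W'' ∣
        size = ≤-trans (∣p∣≤∣exchange∣ x∈W c∉W) (∣p∣≤∣exchange∣ (∈-exchange⁺ ws∈W ws≢x) c'∉W')
        avoids-I : ∀ z → z ∈ W'' → z ∉ I
        avoids-I z z∈W'' with members z∈W''
        ... | inj₁ refl = c'∉I
        ... | inj₂ refl = c∉I

      absurd : ⊥
      absurd with search-W (λ w → ¬? (w ≟ ws))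
      ... | inj₁ (w₂ , w₂∈W , w₂≢x , w₂≢ws) = third-vertex w₂∈W w₂≢x w₂≢ws
      ... | inj₂ W⊆x,ws = two-vertices W⊆x,ws

    absurd : ⊥
    absurd with non-neighbour-in-W c∉I c∉W
    ... | ws , ws∈W , ws≢x , c≁ws = Missing.absurd ws ws∈W ws≢x c≁ws

  -- Main contradiction: pick w₀ ∈ W − x; the member of its avoiding pair adjacent to x is
  -- one of the outside vertices, which plays the role of c'.
  impossible : ∀ {a b} → Layout I W a b → ⊥
  impossible {a} {b} L with non-neighbour-in-W (Layout.c∉I L) (Layout.c∉W L)
  ... | w₀ , w₀∈W , w₀≢x , _ with neighbour-first G (avoiding w₀) (~-sym (x~W w₀∈W w₀≢x))
  ...   | P , e~x with Layout.cover L (AvoidingPair.first P)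
  ...     | inj₁ e∈I = indep e∈I x∈I e~x
  ...     | inj₂ (inj₁ e∈W) = AvoidingPair.first≁v P (clique e∈W w₀∈W (AvoidingPair.first≢v P))
  ...     | inj₂ (inj₂ (inj₁ e≡a)) = Outside.absurd b a (swap-layout L) (subst (_~ x) e≡a e~x)
  ...     | inj₂ (inj₂ (inj₂ e≡b)) = Outside.absurd a b L (subst (_~ x) e≡b e~x)

no-pair-of-critical : (G : Graph n) → MaximalVertexCritical G 3 → ¬ DominatingPair (Adj G) full
no-pair-of-critical G ((_ , (_ , γc≥3) , _) , _) = no-dominating-pair (Graph.sym G) γc≥3

avoiding-of-critical : (G : Graph n) → MaximalVertexCritical G 3 → ∀ v → AvoidingPair G v
avoiding-of-critical G critical@(_ , _ , _ , small) v with small v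
... | _ , cds , size = avoiding-pair G (no-pair-of-critical G critical) (pair-of-small-cds cds size)

adding-of-critical : (G : Graph n) → MaximalVertexCritical G 3 →
  ∀ u v → u ≢ v → ¬ Adj G u v → DominatingPair (addEdge (Adj G) u v) full
adding-of-critical G ((_ , _ , small) , _) u v u≢v u≁v with small u v u≢v u≁v
... | _ , cds , size = pair-of-small-cds cds size

large-cliques-meet-I : ∀ {I W : Subset n} {x} → MaxClique G W →
  (∀ W' → MaxClique G W' → ∣ I ∩ W ∣ ≤ ∣ I ∩ W' ∣) → x ∈ I → x ∈ W →
  ∀ W' → Clique G W' → ∣ W ∣ ≤ ∣ W' ∣ → ¬ (∀ z → z ∈ W' → z ∉ I)
large-cliques-meet-I {G = G} {I = I} {W} (_ , maximum) minimal x∈I x∈W W' clique' ∣W∣≤∣W'∣ avoids =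
  n≮0 (subst (1 ≤_) (Empty⇒∣p∣≡0 I∩W'-empty) (≤-trans 1≤∣I∩W∣ (minimal W' W'-maximum)))
  where
  W'-maximum : MaxClique G W'
  W'-maximum = clique' , λ W'' clique'' → ≤-trans (maximum W'' clique'') ∣W∣≤∣W'∣
  1≤∣I∩W∣ : 1 ≤ ∣ I ∩ W ∣
  1≤∣I∩W∣ = subst (1 ≤_) (sym (∣p∣≡1+∣p-x∣ (x∈p∩q⁺ (x∈I , x∈W)))) (s≤s z≤n)
  I∩W'-empty : Empty (I ∩ W')
  I∩W'-empty (z , z∈I∩W') with x∈p∩q⁻ I W' z∈I∩W'
  ... | z∈I , z∈W' = avoids z z∈W' z∈I

lemma3p5 : ∀ {n} (G : Graph n) → MaximalVertexCritical G 3 →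
    (I W : Subset n) → MaxIndependent G I → MaxClique G W →
    (∀ W' → MaxClique G W' → ∣ I ∩ W ∣ ≤ ∣ I ∩ W' ∣) →
    ∣ I ∣ + ∣ W ∣ ≡ n ∸ 1 →
    ∣ W ∩ I ∣ ≡ 0
lemma3p5 G critical I W (independent , _) maximum@(clique , _) minimal size with nonempty? (W ∩ I)
... | no empty = Empty⇒∣p∣≡0 empty
... | yes (x , x∈W∩I) with x∈p∩q⁻ W I x∈W∩I
...   | x∈W , x∈I with layout-of-complement (∣∁[p∪q]∣≡2 I W ∣I∩W∣≡1 size)
  where
  ∣I∩W∣≡1 : ∣ I ∩ W ∣ ≡ 1
  ∣I∩W∣≡1 = ∣p∣≡1 (x∈p∩q⁺ (x∈I , x∈W)) λ {z} z∈I∩W → let (z∈I , z∈W) = x∈p∩q⁻ I W z∈I∩W in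
    clique∩independent G independent clique x∈I x∈W z∈I z∈W
...     | _ , _ , layout = ⊥-elim (Configuration.impossible G
          (no-pair-of-critical G critical) (avoiding-of-critical G critical) (adding-of-critical G critical)
          I W independent clique (large-cliques-meet-I {G = G} maximum minimal x∈I x∈W) x x∈I x∈W layout)
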